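{- Let $R_{M(\vec{x})}$ be a $(k,n)$-ary symbolic automatic relation, with $\vec{T}=T_0,\ldots,T_{k-1}$ list terms and $\vec{y}=y_0,\ldots,y_{n-1}$ integer variables, and suppose that $R_{M(\vec{x})}(\vec{T},\vec{y})$ is normal. Then $R_{M(\vec{x})}(\vec{T},\vec{y})$ is satisfiable in $\mathcal{M}$ if and only if the set $\Pi$ of constrained Horn clauses translated from $R_{M(\vec{x})}(\vec{T},\vec{y})$ is unsatisfiable modulo $\mathbb{Z}_{\#}$.
   Context: $\mathbb{Z}_{\#}=\mathbb{Z}\cup\{\#\}$ is the partial model of integer arithmetic: functions return $\#$ if some argument is $\#$, predicates are as in $\mathbb{Z}$ (false on $\#$), plus a predicate $\mathrm{isPad}$ true exactly on $\#$. A $(k,n)$-ary ss-NFA $M(\vec{x})=(Q,I,F,\Delta)$ has transitions $q\xrightarrow{\phi}q'$ labelled by formulas over $\mathbb{Z}_{\#}$ with free variables among $l_0,\ldots,l_{k-1}$ (current input letters) and parameters $\vec{x}=x_0,\ldots,x_{n-1}$; $R_{M(\vec{x})}$ is interpreted in the standard integer-list model $\mathcal{M}$ as the set of $(w_0,\ldots,w_{k-1},\vec{j})$ such that the convolution of $w_0,\ldots,w_{k-1}$ (words padded with $\#$ to equal length, read as a word of $k$-tuples) is accepted by $M(\vec{j})$. $R_{M(\vec{x})}(\vec{T},\vec{y})$ is normal if each $y_i$ is an integer variable and $\{T_0,\ldots,T_{k-1}\}$ is cons-free (each $T_i$ is $\mathrm{nil}$ or $\mathrm{tail}^m(X)$)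 and gap-free ($\mathrm{tail}^n(X)$ in the set implies $\mathrm{tail}^m(X)$ in the set for all $0\le m\le n$). The translated set $\Pi$ uses a predicate $P_q$ for each state $q$ and consists of: (1) for each transition $p\xrightarrow{\phi}q\in\Delta$, the clause $P_q(v_0,\ldots,v_{k-1},\vec{x}) \Leftarrow P_p(u_0,\ldots,u_{k-1},\vec{x})\wedge\phi[u_0/l_0,\ldots,u_{k-1}/l_{k-1}]\wedge \mathit{shift}\wedge\mathit{padding}\wedge\neg\mathit{end}$; (2) for each $q\in I$, $P_q(v_0,\ldots,v_{k-1},\vec{x})\Leftarrow \mathit{nilc}\wedge\mathit{tailnil}\wedge\vec{x}=\vec{y}$; (3) for each $q\in F$, $\bot\Leftarrow P_q(u_0,\ldots,u_{k-1},\vec{x})\wedge\mathit{end}$. Here $\mathit{end}:=\bigwedge_i \mathrm{isPad}(u_i)$; $\mathit{shift}:=\bigwedge\{v_i=u_j\vee(\mathrm{isPad}(v_i)\wedge\mathrm{isPad}(u_j)) \mid T_i=\mathrm{tail}^m(X),T_j=\mathrm{tail}^{m+1}(X)\}$; $\mathit{padding}:=\bigwedge_i(\mathrm{isPad}(u_i)\Rightarrow\mathrm{isPad}(v_i))$; $\mathit{nilc}:=\bigwedge\{\mathrm{isPad}(v_i)\mid T_i=\mathrm{nil}\}$; $\mathit{tailnil}:=\bigwedge\{\mathrm{isPad}(v_i)\Rightarrow\mathrm{isPad}(v_j)\mid T_i=\mathrm{tail}^m(X),T_j=\mathrm{tail}^{m+1}(X)\}$. -}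

module Defs where

open import Level using (0ℓ)
open import Data.Nat using (ℕ; zero; suc; _⊔_; _<ᵇ_)
open import Data.Integer as ℤ using (ℤ)
open import Data.Fin using (Fin; zero; suc; splitAt)
open import Data.Fin.Subset using (Subset)
import Data.Fin.Subset as Sub
open import Data.List using (List; []; _∷_; length; map; foldr; upTo; allFin)
import Data.List as L
open import Data.List.Membership.Propositional as LM using ()
open import Data.Product using (Σ; ∃; _×_; _,_)
open import Data.Sum using (_⊎_; [_,_]′)
open import Data.Empty using (⊥)
open import Data.Unit using (⊤)
open import Relation.Nullary using (¬_)
open import Relation.Binary.PropositionalEquality using (_≡_)
open import Data.Vec.Functional using () renaming (_∷_ to _▹_)

data Z# : Set where
  int : ℤ → Z#
  pad : Z#

lift₂ : (ℤ → ℤ → ℤ) → Z# → Z# → Z#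
lift₂ f (int a) (int b) = int (f a b)
lift₂ f _       _       = pad

lift₁ : (ℤ → ℤ) → Z# → Z#
lift₁ f (int a) = int (f a)
lift₁ f pad     = pad

EqZ : Z# → Z# → Set
EqZ (int a) (int b) = a ≡ b
EqZ _       _       = ⊥

LeZ : Z# → Z# → Set
LeZ (int a) (int b) = a ℤ.≤ b
LeZ _       _       = ⊥

LtZ : Z# → Z# → Set
LtZ (int a) (int b) = a ℤ.< b
LtZ _       _       = ⊥

IsPad : Z# → Set
IsPad z = z ≡ pad

data Tm (m : ℕ) : Set where
  var : Fin m → Tm m
  lit : ℤ → Tm m
  _⊕_ : Tm m → Tm m → Tm m
  _⊗_ : Tm m → Tm m → Tm m
  ⊖_  : Tm m → Tm m

data Fml : ℕ → Set where
  tt ff       : ∀ {m} → Fml m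
  eq le lt    : ∀ {m} → Tm m → Tm m → Fml m
  isPad       : ∀ {m} → Tm m → Fml m
  not         : ∀ {m} → Fml m → Fml m
  and or imp  : ∀ {m} → Fml m → Fml m → Fml m
  ex all      : ∀ {m} → Fml (suc m) → Fml m

⟦_⟧t : ∀ {m} → Tm m → (Fin m → Z#) → Z#
⟦ var i ⟧t ρ = ρ i
⟦ lit a ⟧t ρ = int a
⟦ s ⊕ t ⟧t ρ = lift₂ ℤ._+_ (⟦ s ⟧t ρ) (⟦ t ⟧t ρ)
⟦ s ⊗ t ⟧t ρ = lift₂ ℤ._*_ (⟦ s ⟧t ρ) (⟦ t ⟧t ρ)
⟦ ⊖ t ⟧t ρ   = lift₁ ℤ.-_ (⟦ t ⟧t ρ)

⟦_⟧f : ∀ {m} → Fml m → (Fin m → Z#) → Set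
⟦ tt ⟧f ρ      = ⊤
⟦ ff ⟧f ρ      = ⊥
⟦ eq s t ⟧f ρ  = EqZ (⟦ s ⟧t ρ) (⟦ t ⟧t ρ)
⟦ le s t ⟧f ρ  = LeZ (⟦ s ⟧t ρ) (⟦ t ⟧t ρ)
⟦ lt s t ⟧f ρ  = LtZ (⟦ s ⟧t ρ) (⟦ t ⟧t ρ)
⟦ isPad t ⟧f ρ = IsPad (⟦ t ⟧t ρ)
⟦ not φ ⟧f ρ   = ¬ ⟦ φ ⟧f ρ
⟦ and φ ψ ⟧f ρ = ⟦ φ ⟧f ρ × ⟦ ψ ⟧f ρ
⟦ or φ ψ ⟧f ρ  = ⟦ φ ⟧f ρ ⊎ ⟦ ψ ⟧f ρ
⟦ imp φ ψ ⟧f ρ = ⟦ φ ⟧f ρ → ⟦ ψ ⟧f ρ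
⟦ ex φ ⟧f ρ    = Σ Z# λ z → ⟦ φ ⟧f (z ▹ ρ)
⟦ all φ ⟧f ρ   = (z : Z#) → ⟦ φ ⟧f (z ▹ ρ)

-- (k,n)-ary ss-NFA.  Transition labels are formulas with k + n free
-- variables: variable i < k is the letter l_i, variable k + j is x_j.

record SSNFA (k n : ℕ) : Set where
  field
    nQ : ℕ
    I  : Subset nQ
    F  : Subset nQ
    Δ  : List (Fin nQ × Fml (Data.Nat._+_ k n) × Fin nQ)

open SSNFA public

env : ∀ {k n} → (Fin k → Z#) → (Fin n → Z#) → Fin (Data.Nat._+_ k n) → Z#
env {k} l x i = [ l , x ]′ (splitAt k i)

data Acc {k n} (M : SSNFA k n) (j : Fin n → ℤ) : Fin (nQ M) → List (Fin k → Z#) → Set where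
  done : ∀ {q} → q Sub.∈ F M → Acc M j q []
  step : ∀ {p φ q a w} → (p , φ , q) LM.∈ Δ M →
         ⟦ φ ⟧f (env a (λ i → int (j i))) → Acc M j q w → Acc M j p (a ∷ w)

Accepts : ∀ {k n} → SSNFA k n → (Fin n → ℤ) → List (Fin k → Z#) → Set
Accepts M j w = ∃ λ q → q Sub.∈ I M × Acc M j q w

at : List ℤ → ℕ → Z#
at []       _       = pad
at (a ∷ w)  zero    = int a
at (a ∷ w)  (suc p) = at w p

maxLen : ∀ {k} → (Fin k → List ℤ) → ℕ
maxLen {k} w = foldr _⊔_ 0 (map (λ i → length (w i)) (allFin k))

conv : ∀ {k} → (Fin k → List ℤ) → List (Fin k → Z#)
conv w = map (λ p i → at (w i) p) (upTo (maxLen w))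

InR : ∀ {k n} → SSNFA k n → (Fin k → List ℤ) → (Fin n → ℤ) → Set
InR M w j = Accepts M j (conv w)

mutual
  data LTerm : Set where
    nil  : LTerm
    lvar : ℕ → LTerm
    tail : LTerm → LTerm
    cons : ITerm → LTerm → LTerm

  data ITerm : Set where
    ivar : ℕ → ITerm
    ilit : ℤ → ITerm
    _+ᵢ_ : ITerm → ITerm → ITerm
    _*ᵢ_ : ITerm → ITerm → ITerm
    -ᵢ_  : ITerm → ITerm
    head : LTerm → ITerm

tail^ : ℕ → LTerm → LTerm
tail^ zero    t = t
tail^ (suc m) t = tail (tail^ m t)

-- standard model; convention: tail nil = nil, head nil = 0
mutual
  ⟦_⟧L : LTerm → (ℕ → List ℤ) → (ℕ → ℤ) → List ℤ
  ⟦ nil ⟧L σ ρ      = []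
  ⟦ lvar X ⟧L σ ρ   = σ X
  ⟦ tail t ⟧L σ ρ   = L.drop 1 (⟦ t ⟧L σ ρ)
  ⟦ cons a t ⟧L σ ρ = ⟦ a ⟧I σ ρ ∷ ⟦ t ⟧L σ ρ

  ⟦_⟧I : ITerm → (ℕ → List ℤ) → (ℕ → ℤ) → ℤ
  ⟦ ivar z ⟧I σ ρ  = ρ z
  ⟦ ilit a ⟧I σ ρ  = a
  ⟦ s +ᵢ t ⟧I σ ρ  = ⟦ s ⟧I σ ρ ℤ.+ ⟦ t ⟧I σ ρ
  ⟦ s *ᵢ t ⟧I σ ρ  = ⟦ s ⟧I σ ρ ℤ.* ⟦ t ⟧I σ ρ
  ⟦ -ᵢ t ⟧I σ ρ    = ℤ.- ⟦ t ⟧I σ ρ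
  ⟦ head t ⟧I σ ρ  = hd (⟦ t ⟧L σ ρ)
    where
    hd : List ℤ → ℤ
    hd []      = ℤ.0ℤ
    hd (a ∷ _) = a

SatM : ∀ {k n} → SSNFA k n → (Fin k → LTerm) → (Fin n → ℕ) → Set
SatM M T y = ∃ λ (σ : ℕ → List ℤ) → ∃ λ (ρ : ℕ → ℤ) →
  InR M (λ i → ⟦ T i ⟧L σ ρ) (λ i → ρ (y i))

InTerms : ∀ {k} → (Fin k → LTerm) → LTerm → Set
InTerms T t = ∃ λ i → T i ≡ t

ConsFree : ∀ {k} → (Fin k → LTerm) → Set
ConsFree T = ∀ i → T i ≡ nil ⊎ (∃ λ m → ∃ λ X → T i ≡ tail^ m (lvar X))

GapFree : ∀ {k} → (Fin k → LTerm) → Set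
GapFree T = ∀ X m n → m Data.Nat.≤ n →
  InTerms T (tail^ n (lvar X)) → InTerms T (tail^ m (lvar X))

-- y is already a tuple of integer variables (indices ℕ)
Normal : ∀ {k} → (Fin k → LTerm) → Set
Normal T = ConsFree T × GapFree T

-- CHC variables v_i, u_i are the variables
-- associated to the term T_i; a valuation of them is a map LTerm → Z#
-- (so v_i = V (T i)).  x : Fin n → Z#, y-variables : ℕ → Z#.

module _ {k : ℕ} (T : Fin k → LTerm) where

  End : (LTerm → Z#) → Set
  End U = ∀ i → IsPad (U (T i))

  Shift : (LTerm → Z#) → (LTerm → Z#) → Set
  Shift V U = ∀ i j m X → T i ≡ tail^ m (lvar X) → T j ≡ tail^ (suc m) (lvar X) →
    EqZ (V (T i)) (U (T j)) ⊎ (IsPad (V (T i)) × IsPad (U (T j)))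

  Padding : (LTerm → Z#) → (LTerm → Z#) → Set
  Padding V U = ∀ i → IsPad (U (T i)) → IsPad (V (T i))

  Nilc : (LTerm → Z#) → Set
  Nilc V = ∀ i → T i ≡ nil → IsPad (V (T i))

  Tailnil : (LTerm → Z#) → Set
  Tailnil V = ∀ i j m X → T i ≡ tail^ m (lvar X) → T j ≡ tail^ (suc m) (lvar X) →
    IsPad (V (T i)) → IsPad (V (T j))

Interp : ∀ {k n} → SSNFA k n → Set₁
Interp {k} {n} M = Fin (nQ M) → (Fin k → Z#) → (Fin n → Z#) → Set

TransClauses : ∀ {k n} (M : SSNFA k n) → (Fin k → LTerm) → Interp M → Set
TransClauses {k} {n} M T P = ∀ {p φ q} → (p , φ , q) LM.∈ Δ M →
  ∀ (V U : LTerm → Z#) (x : Fin n → Z#) →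
  P p (λ i → U (T i)) x → ⟦ φ ⟧f (env (λ i → U (T i)) x) →
  Shift T V U → Padding T V U → ¬ End T U →
  P q (λ i → V (T i)) x

InitClauses : ∀ {k n} (M : SSNFA k n) → (Fin k → LTerm) → (Fin n → ℕ) → Interp M → Set
InitClauses {k} {n} M T y P = ∀ q → q Sub.∈ I M →
  ∀ (V : LTerm → Z#) (x : Fin n → Z#) (Y : ℕ → Z#) →
  Nilc T V → Tailnil T V → (∀ i → EqZ (x i) (Y (y i))) →
  P q (λ i → V (T i)) x

FinalClauses : ∀ {k n} (M : SSNFA k n) → (Fin k → LTerm) → Interp M → Set
FinalClauses {k} {n} M T P = ∀ q → q Sub.∈ F M →
  ∀ (U : LTerm → Z#) (x : Fin n → Z#) →
  P q (λ i → U (T i)) x → End T U → ⊥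

ΠSat : ∀ {k n} → SSNFA k n → (Fin k → LTerm) → (Fin n → ℕ) → Set₁
ΠSat M T y = Σ (Interp M) λ P →
  TransClauses M T P × InitClauses M T y P × FinalClauses M T P

-- Think of the CHC variable attached to T i at step t of a derivation as the letter at
-- position t of the word T i.  A model of R gives an accepting run over the convolution,
-- and its columns form a chain of clause instances (initial, transitions, goal) that
-- refutes every interpretation of the predicates P_q.  Conversely, reading P_q(a, x) as
-- "every coherent accepting run of M(x) from q whose first column is a yields a model of
-- R" satisfies the transition and initial clauses, and also the goal clauses as soon as R
-- is unsatisfiable.  Normality is what lets a coherent run be read back as lists: without
-- cons and without gaps, the column of tail^m X at step t is the column of X at step m + t.
-- Only the final step, from ¬¬ SatM to SatM, is classical.

module Submission where

open import Defs
open import Data.Nat using (ℕ)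
open import Data.Fin using (Fin)
open import Relation.Nullary using (¬_)
open import Function.Bundles using (_⇔_)
open import Axiom.ExcludedMiddle using (ExcludedMiddle)
open import Level using (0ℓ)

open import Axiom.DoubleNegationElimination using (em⇒dne)
open import Data.Nat using (zero; suc; _+_; _≤_; z≤n; s≤s; s≤s⁻¹)
open import Data.Nat.Properties using (+-suc; ≤-antisym; ≤-trans; ≤-refl; n≤1+n; ⊔-lub; m⊔n≤o⇒m≤o; m⊔n≤o⇒n≤o)
open import Data.Fin as Fin using (splitAt)
open import Data.Integer using (ℤ; 0ℤ)
import Data.Integer as ℤ
open import Data.List using (List; []; _∷_; length; applyUpTo; allFin)
import Data.List as L
open import Data.List.Properties using (foldr-preservesᵇ; foldr-forcesᵇ; map-upTo)
open import Data.List.Relation.Unary.All as All using (All)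
open import Data.List.Relation.Unary.All.Properties using (map⁺; map⁻; tabulate⁺)
open import Data.List.Membership.Propositional using (_∈_)
open import Data.List.Membership.Propositional.Properties using (∈-allFin)
import Data.Fin.Subset as Sub
open import Data.Product using (_×_; _,_; proj₁; proj₂)
open import Data.Sum using (_⊎_; inj₁; inj₂)
open import Data.Empty using (⊥; ⊥-elim)
open import Data.Vec.Functional using () renaming (_∷_ to _▹_)
open import Function using (_∘_; mk⇔)
open import Relation.Binary.PropositionalEquality
open ≡-Reasoning

⟦⟧t-resp : ∀ {m} (t : Tm m) {ρ ρ′ : Fin m → Z#} → ρ ≗ ρ′ → ⟦ t ⟧t ρ ≡ ⟦ t ⟧t ρ′
⟦⟧t-resp (var i) e = e i
⟦⟧t-resp (lit a) e = refl
⟦⟧t-resp (s ⊕ t) e = cong₂ (lift₂ ℤ._+_) (⟦⟧t-resp s e) (⟦⟧t-resp t e)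
⟦⟧t-resp (s ⊗ t) e = cong₂ (lift₂ ℤ._*_) (⟦⟧t-resp s e) (⟦⟧t-resp t e)
⟦⟧t-resp (⊖ t)   e = cong (lift₁ (ℤ.-_)) (⟦⟧t-resp t e)

▹-resp : ∀ {m} (z : Z#) {ρ ρ′ : Fin m → Z#} → ρ ≗ ρ′ → (z ▹ ρ) ≗ (z ▹ ρ′)
▹-resp z e Fin.zero    = refl
▹-resp z e (Fin.suc i) = e i

⟦⟧f-resp : ∀ {m} (φ : Fml m) {ρ ρ′ : Fin m → Z#} → ρ ≗ ρ′ → ⟦ φ ⟧f ρ → ⟦ φ ⟧f ρ′
⟦⟧f-resp tt        e h = h
⟦⟧f-resp ff        e h = h
⟦⟧f-resp (eq s t)  e h = subst₂ EqZ (⟦⟧t-resp s e) (⟦⟧t-resp t e) h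
⟦⟧f-resp (le s t)  e h = subst₂ LeZ (⟦⟧t-resp s e) (⟦⟧t-resp t e) h
⟦⟧f-resp (lt s t)  e h = subst₂ LtZ (⟦⟧t-resp s e) (⟦⟧t-resp t e) h
⟦⟧f-resp (isPad t) e h = subst IsPad (⟦⟧t-resp t e) h
⟦⟧f-resp (not φ)   e h = λ p → h (⟦⟧f-resp φ (λ i → sym (e i)) p)
⟦⟧f-resp (and φ ψ) e (p , q) = ⟦⟧f-resp φ e p , ⟦⟧f-resp ψ e q
⟦⟧f-resp (or φ ψ)  e (inj₁ p) = inj₁ (⟦⟧f-resp φ e p)
⟦⟧f-resp (or φ ψ)  e (inj₂ q) = inj₂ (⟦⟧f-resp ψ e q)
⟦⟧f-resp (imp φ ψ) e h = λ p → ⟦⟧f-resp ψ e (h (⟦⟧f-resp φ (λ i → sym (e i)) p))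
⟦⟧f-resp (ex φ)    e (z , p) = z , ⟦⟧f-resp φ (▹-resp z e) p
⟦⟧f-resp (all φ)   e h = λ z → ⟦⟧f-resp φ (▹-resp z e) (h z)

env-resp : ∀ {k n} {l l′ : Fin k → Z#} {x x′ : Fin n → Z#} → l ≗ l′ → x ≗ x′ → env l x ≗ env l′ x′
env-resp {k} l≗l′ x≗x′ i with splitAt k i
... | inj₁ a = l≗l′ a
... | inj₂ b = x≗x′ b

value : Z# → ℤ
value (int a) = a
value pad     = 0ℤ

EqZ⇒≡int : ∀ {a b} → EqZ a b → a ≡ int (value b)
EqZ⇒≡int {int a} {int b} e = cong int e
EqZ⇒≡int {int a} {pad}   ()
EqZ⇒≡int {pad}           ()

EqZ⊎pads⇒≡ : ∀ {a b} → EqZ a b ⊎ (IsPad a × IsPad b) → a ≡ b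
EqZ⊎pads⇒≡ {int a} {int b} (inj₁ e) = cong int e
EqZ⊎pads⇒≡ {int a} {pad}   (inj₁ ())
EqZ⊎pads⇒≡ {pad}           (inj₁ ())
EqZ⊎pads⇒≡ (inj₂ (a≡pad , b≡pad)) = trans a≡pad (sym b≡pad)

≡⇒EqZ⊎pads : ∀ {a b} → a ≡ b → EqZ a b ⊎ (IsPad a × IsPad b)
≡⇒EqZ⊎pads {int a} refl = inj₁ refl
≡⇒EqZ⊎pads {pad}   refl = inj₂ (refl , refl)

data Acc# {k n} (M : SSNFA k n) (x : Fin n → Z#) : Fin (nQ M) → List (Fin k → Z#) → Set where
  done : ∀ {q} → q Sub.∈ F M → Acc# M x q []
  step : ∀ {p φ q a w} → (p , φ , q) ∈ Δ M →
         ⟦ φ ⟧f (env a x) → Acc# M x q w → Acc# M x p (a ∷ w)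

Acc#⇒Acc : ∀ {k n} {M : SSNFA k n} {x : Fin n → Z#} {j : Fin n → ℤ} {f g : ℕ → Fin k → Z#} r {q} →
  (∀ t → g t ≗ f t) → x ≗ (λ i → int (j i)) →
  Acc# M x q (applyUpTo g r) → Acc M j q (applyUpTo f r)
Acc#⇒Acc zero    g≗f x≗j (done q∈F) = done q∈F
Acc#⇒Acc (suc r) g≗f x≗j (step {φ = φ} t∈Δ holds acc) =
  step t∈Δ (⟦⟧f-resp φ (env-resp (g≗f 0) x≗j) holds) (Acc#⇒Acc r (g≗f ∘ suc) x≗j acc)

PadClosed : (ℕ → Z#) → Set
PadClosed f = ∀ t → f t ≡ pad → f (suc t) ≡ pad

padClosed-from-0 : ∀ {f} → PadClosed f → f 0 ≡ pad → ∀ t → f t ≡ pad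
padClosed-from-0 closed f0≡pad zero    = f0≡pad
padClosed-from-0 closed f0≡pad (suc t) = closed t (padClosed-from-0 closed f0≡pad t)

at-padClosed : ∀ l → PadClosed (at l)
at-padClosed []      _       _  = refl
at-padClosed (a ∷ l) zero    ()
at-padClosed (a ∷ l) (suc t) e  = at-padClosed l t e

at-drop-1 : ∀ l t → at (L.drop 1 l) t ≡ at l (suc t)
at-drop-1 []      t = refl
at-drop-1 (a ∷ l) t = refl

at-⟦tail^⟧ : ∀ m tm σ ρ t → at (⟦ tail^ m tm ⟧L σ ρ) t ≡ at (⟦ tm ⟧L σ ρ) (m + t)
at-⟦tail^⟧ zero    tm σ ρ t = refl
at-⟦tail^⟧ (suc m) tm σ ρ t = begin
  at (L.drop 1 (⟦ tail^ m tm ⟧L σ ρ)) t ≡⟨ at-drop-1 (⟦ tail^ m tm ⟧L σ ρ) t ⟩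
  at (⟦ tail^ m tm ⟧L σ ρ) (suc t)      ≡⟨ at-⟦tail^⟧ m tm σ ρ (suc t) ⟩
  at (⟦ tm ⟧L σ ρ) (m + suc t)          ≡⟨ cong (at (⟦ tm ⟧L σ ρ)) (+-suc m t) ⟩
  at (⟦ tm ⟧L σ ρ) (suc m + t)          ∎

length≤⇒at≡pad : ∀ l {t} → length l ≤ t → at l t ≡ pad
length≤⇒at≡pad []      h       = refl
length≤⇒at≡pad (a ∷ l) (s≤s h) = length≤⇒at≡pad l h

at≡pad⇒length≤ : ∀ l t → at l t ≡ pad → length l ≤ t
at≡pad⇒length≤ []      t       e  = z≤n
at≡pad⇒length≤ (a ∷ l) zero    ()
at≡pad⇒length≤ (a ∷ l) (suc t) e  = s≤s (at≡pad⇒length≤ l t e)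

_∷#_ : Z# → List ℤ → List ℤ
int a ∷# l = a ∷ l
pad   ∷# l = []

prefix : ℕ → (ℕ → Z#) → List ℤ
prefix zero    f = []
prefix (suc b) f = f 0 ∷# prefix b (f ∘ suc)

at-prefix : ∀ b {f} → PadClosed f → f b ≡ pad → ∀ t → at (prefix b f) t ≡ f t
at-prefix zero    closed fb≡pad t = sym (padClosed-from-0 closed fb≡pad t)
at-prefix (suc b) {f} closed fb≡pad t with f 0 in f0
at-prefix (suc b) closed fb≡pad zero    | int a = sym f0
at-prefix (suc b) closed fb≡pad (suc t) | int a = at-prefix b (closed ∘ suc) fb≡pad t
at-prefix (suc b) closed _     t       | pad   = sym (padClosed-from-0 closed f0 t)

length≤maxLen : ∀ {k} (w : Fin k → List ℤ) i → length (w i) ≤ maxLen w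
length≤maxLen {k} w i = All.lookup (map⁻ bounded) (∈-allFin i)
  where
  bounded : All (_≤ maxLen w) (L.map (λ i → length (w i)) (allFin k))
  bounded = foldr-forcesᵇ (λ m n h → m⊔n≤o⇒m≤o m n h , m⊔n≤o⇒n≤o m n h) 0 _ ≤-refl

maxLen-lub : ∀ {k} (w : Fin k → List ℤ) {N} → (∀ i → length (w i) ≤ N) → maxLen w ≤ N
maxLen-lub w {N} bounded = foldr-preservesᵇ {P = _≤ N} ⊔-lub z≤n (map⁺ (tabulate⁺ bounded))

all-pad⇒maxLen≤ : ∀ {k} (w : Fin k → List ℤ) {t} → (∀ i → at (w i) t ≡ pad) → maxLen w ≤ t
all-pad⇒maxLen≤ w {t} pads = maxLen-lub w (λ i → at≡pad⇒length≤ (w i) t (pads i))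

maxLen≤⇒all-pad : ∀ {k} (w : Fin k → List ℤ) {t} → maxLen w ≤ t → ∀ i → at (w i) t ≡ pad
maxLen≤⇒all-pad w h i = length≤⇒at≡pad (w i) (≤-trans (length≤maxLen w i) h)

Columns : Set
Columns = ℕ → LTerm → Z#

-- A coherent family of length r is the sequence of valuations along a chain of
-- transition-clause instances of Π that ends, at step r, in a goal-clause instance.
record Coherent {k} (T : Fin k → LTerm) (c : Columns) (r : ℕ) : Set where
  field
    shift           : ∀ t → Shift T (c (suc t)) (c t)
    padding         : ∀ t → Padding T (c (suc t)) (c t)
    ends            : End T (c r)
    ends-only-after : ∀ t → End T (c t) → r ≤ t

open Coherent

columns : ∀ {k} → (Fin k → LTerm) → Columns → ℕ → List (Fin k → Z#)
columns T c r = applyUpTo (λ t i → c t (T i)) r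

_◃_ : (LTerm → Z#) → Columns → Columns
(U ◃ c) zero    = U
(U ◃ c) (suc t) = c t

pads : Columns
pads _ _ = pad

module _ {k} {T : Fin k → LTerm} where

  coherent-suc : ∀ {c r} → Coherent T c (suc r) → Coherent T (c ∘ suc) r
  coherent-suc coh .shift t               = shift coh (suc t)
  coherent-suc coh .padding t             = padding coh (suc t)
  coherent-suc coh .ends                  = ends coh
  coherent-suc coh .ends-only-after t end = s≤s⁻¹ (ends-only-after coh (suc t) end)

  coherent-◃ : ∀ {U c r} → Shift T (c 0) U → Padding T (c 0) U → ¬ End T U →
    Coherent T c r → Coherent T (U ◃ c) (suc r)
  coherent-◃ sh pd ¬end coh .shift zero                  = sh
  coherent-◃ sh pd ¬end coh .shift (suc t)               = shift coh t
  coherent-◃ sh pd ¬end coh .padding zero                = pd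
  coherent-◃ sh pd ¬end coh .padding (suc t)             = padding coh t
  coherent-◃ sh pd ¬end coh .ends                        = ends coh
  coherent-◃ sh pd ¬end coh .ends-only-after zero end    = ⊥-elim (¬end end)
  coherent-◃ sh pd ¬end coh .ends-only-after (suc t) end = s≤s (ends-only-after coh t end)

  coherent-end : ∀ {U} → End T U → Coherent T (U ◃ pads) 0
  coherent-end end .shift zero _ j _ _ _ _    = inj₂ (refl , end j)
  coherent-end end .shift (suc _) _ _ _ _ _ _ = inj₂ (refl , refl)
  coherent-end end .padding _ _ _             = refl
  coherent-end end .ends                      = end
  coherent-end end .ends-only-after _ _       = z≤n

  coherent⇒tailnil : ∀ {c r} → Coherent T c r → Tailnil T (c 0)
  coherent⇒tailnil coh i j m X ei ej c₀≡pad =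
    trans (sym (EqZ⊎pads⇒≡ (shift coh 0 i j m X ei ej))) (padding coh 0 i c₀≡pad)

  Shift-respˡ : ∀ {V V′ U} → (∀ i → V (T i) ≡ V′ (T i)) → Shift T V U → Shift T V′ U
  Shift-respˡ {U = U} V≡V′ sh i j m X ei ej =
    subst (λ z → EqZ z (U (T j)) ⊎ (IsPad z × IsPad (U (T j)))) (V≡V′ i) (sh i j m X ei ej)

  Padding-respˡ : ∀ {V V′ U} → (∀ i → V (T i) ≡ V′ (T i)) → Padding T V U → Padding T V′ U
  Padding-respˡ V≡V′ pd i U≡pad = trans (sym (V≡V′ i)) (pd i U≡pad)

  maxLen≡end : ∀ {c r} (w : Fin k → List ℤ) → (∀ i t → at (w i) t ≡ c t (T i)) →
    Coherent T c r → maxLen w ≡ r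
  maxLen≡end w w≡c coh = ≤-antisym
    (all-pad⇒maxLen≤ w (λ i → trans (w≡c i _) (ends coh i)))
    (ends-only-after coh _ (λ i → trans (sym (w≡c i _)) (maxLen≤⇒all-pad w ≤-refl i)))

module _ {k n} {M : SSNFA k n} {T : Fin k → LTerm} {P : Interp M}
         (transition : TransClauses M T P) (goal : FinalClauses M T P) (j : Fin n → ℤ) where

  clauses-refute-run : ∀ {q c} r → Coherent T c r → Acc M j q (columns T c r) →
    P q (λ i → c 0 (T i)) (λ i → int (j i)) → ⊥
  clauses-refute-run {c = c} zero coh (done q∈F) Pq = goal _ q∈F (c 0) _ Pq (ends coh)
  clauses-refute-run {c = c} (suc r) coh (step t∈Δ holds acc) Pp =
    clauses-refute-run r (coherent-suc coh) acc
      (transition t∈Δ (c 1) (c 0) _ Pp holds (shift coh 0) (padding coh 0) not-ended)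
    where
    not-ended : ¬ End T (c 0)
    not-ended end with ends-only-after coh 0 end
    ... | ()

module _ (σ : ℕ → List ℤ) (ρ : ℕ → ℤ) where

  columnsOf : Columns
  columnsOf t tm = at (⟦ tm ⟧L σ ρ) t

  columnsOf-coherent : ∀ {k} (T : Fin k → LTerm) → Coherent T columnsOf (maxLen (λ i → ⟦ T i ⟧L σ ρ))
  columnsOf-coherent T .shift t i j m X ei ej rewrite ei | ej =
    ≡⇒EqZ⊎pads (sym (at-drop-1 (⟦ tail^ m (lvar X) ⟧L σ ρ) t))
  columnsOf-coherent T .padding t i         = at-padClosed (⟦ T i ⟧L σ ρ) t
  columnsOf-coherent T .ends                = maxLen≤⇒all-pad (λ i → ⟦ T i ⟧L σ ρ) ≤-refl
  columnsOf-coherent T .ends-only-after _   = all-pad⇒maxLen≤ (λ i → ⟦ T i ⟧L σ ρ)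

SatM⇒¬ΠSat : ∀ {k n} (M : SSNFA k n) (T : Fin k → LTerm) (y : Fin n → ℕ) → SatM M T y → ¬ ΠSat M T y
SatM⇒¬ΠSat M T y (σ , ρ , q , q∈I , acc) (P , transition , initial , goal) =
  clauses-refute-run {P = P} transition goal j _ coherent (subst (Acc M j q) (map-upTo _ _) acc)
    (initial q q∈I (c 0) _ (λ z → int (ρ z)) nilc (coherent⇒tailnil coherent) (λ _ → refl))
  where
  c : Columns
  c = columnsOf σ ρ
  j : Fin _ → ℤ
  j i = ρ (y i)
  coherent : Coherent T c (maxLen (λ i → ⟦ T i ⟧L σ ρ))
  coherent = columnsOf-coherent σ ρ T
  nilc : Nilc T (c 0)
  nilc i Ti≡nil = cong (c 0) Ti≡nil

module Realise {k} {T : Fin k → LTerm} (normal : Normal T)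
               {c : Columns} {r : ℕ} (coh : Coherent T c r) (nilc : Nilc T (c 0)) where

  private
    consFree : ConsFree T
    consFree = proj₁ normal

    gapFree : GapFree T
    gapFree = proj₂ normal

  column-closed : ∀ {tm} → InTerms T tm → PadClosed (λ t → c t tm)
  column-closed (i , refl) t = padding coh t i

  column-ends : ∀ {tm} → InTerms T tm → c r tm ≡ pad
  column-ends (i , refl) = ends coh i

  shifted : ∀ {m X} → InTerms T (tail^ m (lvar X)) → InTerms T (tail^ (suc m) (lvar X)) →
    ∀ t → c t (tail^ (suc m) (lvar X)) ≡ c (suc t) (tail^ m (lvar X))
  shifted {m} {X} (i , ei) (j , ej) t =
    sym (subst₂ (λ a b → c (suc t) a ≡ c t b) ei ej (EqZ⊎pads⇒≡ (shift coh t i j m X ei ej)))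

  tail^-column : ∀ m {X} → InTerms T (tail^ m (lvar X)) → ∀ t → c t (tail^ m (lvar X)) ≡ c (m + t) (lvar X)
  tail^-column zero    _  t = refl
  tail^-column (suc m) {X} in-T t = begin
    c t (tail^ (suc m) (lvar X)) ≡⟨ shifted in-T′ in-T t ⟩
    c (suc t) (tail^ m (lvar X)) ≡⟨ tail^-column m in-T′ (suc t) ⟩
    c (m + suc t) (lvar X)       ≡⟨ cong (λ s → c s (lvar X)) (+-suc m t) ⟩
    c (suc m + t) (lvar X)       ∎
    where
    in-T′ : InTerms T (tail^ m (lvar X))
    in-T′ = gapFree X m (suc m) (n≤1+n m) in-T

  σ : ℕ → List ℤ
  σ X = prefix r (λ t → c t (lvar X))

  module _ (ρ : ℕ → ℤ) where

    realises-nil : InTerms T nil → ∀ t → at (⟦ nil ⟧L σ ρ) t ≡ c t nil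
    realises-nil (i , Ti≡nil) t =
      sym (padClosed-from-0 (column-closed (i , Ti≡nil)) c₀≡pad t)
      where
      c₀≡pad : c 0 nil ≡ pad
      c₀≡pad = subst (λ tm → c 0 tm ≡ pad) Ti≡nil (nilc i Ti≡nil)

    realises-tail^ : ∀ m {X} → InTerms T (tail^ m (lvar X)) →
      ∀ t → at (⟦ tail^ m (lvar X) ⟧L σ ρ) t ≡ c t (tail^ m (lvar X))
    realises-tail^ m {X} in-T t = begin
      at (⟦ tail^ m (lvar X) ⟧L σ ρ) t ≡⟨ at-⟦tail^⟧ m (lvar X) σ ρ t ⟩
      at (σ X) (m + t)                  ≡⟨ at-prefix r (column-closed X∈T) (column-ends X∈T) (m + t) ⟩
      c (m + t) (lvar X)                ≡⟨ sym (tail^-column m in-T t) ⟩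
      c t (tail^ m (lvar X))            ∎
      where
      X∈T : InTerms T (lvar X)
      X∈T = gapFree X 0 m z≤n in-T

    realises : ∀ i t → at (⟦ T i ⟧L σ ρ) t ≡ c t (T i)
    realises i t with consFree i
    ... | inj₁ Ti≡nil =
      subst (λ tm → at (⟦ tm ⟧L σ ρ) t ≡ c t tm) (sym Ti≡nil) (realises-nil (i , Ti≡nil) t)
    ... | inj₂ (m , X , Ti≡tail^) =
      subst (λ tm → at (⟦ tm ⟧L σ ρ) t ≡ c t tm) (sym Ti≡tail^) (realises-tail^ m (i , Ti≡tail^) t)

    realised-run : ∀ {n} {M : SSNFA k n} {x : Fin n → Z#} {j : Fin n → ℤ} {q} →
      x ≗ (λ i → int (j i)) → Acc# M x q (columns T c r) → Acc M j q (conv (λ i → ⟦ T i ⟧L σ ρ))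
    realised-run {M = M} {j = j} {q} x≗j acc =
      subst (Acc M j q) (sym (trans (map-upTo _ _) (cong (applyUpTo _) maxLen≡r)))
        (Acc#⇒Acc r (λ t i → sym (realises i t)) x≗j acc)
      where
      maxLen≡r : maxLen (λ i → ⟦ T i ⟧L σ ρ) ≡ r
      maxLen≡r = maxLen≡end (λ i → ⟦ T i ⟧L σ ρ) realises coh

module _ {k n} (M : SSNFA k n) (T : Fin k → LTerm) (y : Fin n → ℕ) where

  RunsSatisfy : Interp M
  RunsSatisfy q a x = ∀ c r → Coherent T c r → a ≡ (λ i → c 0 (T i)) →
    Acc# M x q (columns T c r) → SatM M T y

  runsSatisfy-transition : TransClauses M T RunsSatisfy
  runsSatisfy-transition t∈Δ V U _ Pp holds sh pd ¬end c r coh V≡c₀ acc =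
    Pp (U ◃ c) (suc r) coh′ refl (step t∈Δ holds acc)
    where
    coh′ : Coherent T (U ◃ c) (suc r)
    coh′ = coherent-◃ (Shift-respˡ {T = T} {V} {c 0} {U} (cong-app V≡c₀) sh)
                      (Padding-respˡ {T = T} {V} {c 0} {U} (cong-app V≡c₀) pd) ¬end coh

  runsSatisfy-initial : Normal T → InitClauses M T y RunsSatisfy
  runsSatisfy-initial normal q q∈I _ _ Y nilc _ x≈Y c r coh V≡c₀ acc =
    σ , ρ , q , q∈I , realised-run ρ (λ i → EqZ⇒≡int (x≈Y i)) acc
    where
    ρ : ℕ → ℤ
    ρ z = value (Y z)
    open Realise normal coh (λ i Ti≡nil → trans (sym (cong-app V≡c₀ i)) (nilc i Ti≡nil))

  runsSatisfy-goal : ¬ SatM M T y → FinalClauses M T RunsSatisfy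
  runsSatisfy-goal ¬sat _ q∈F U _ Pq end = ¬sat (Pq (U ◃ pads) 0 (coherent-end end) refl (done q∈F))

  ¬SatM⇒ΠSat : Normal T → ¬ SatM M T y → ΠSat M T y
  ¬SatM⇒ΠSat normal ¬sat =
    RunsSatisfy , runsSatisfy-transition , runsSatisfy-initial normal , runsSatisfy-goal ¬sat

theorem1 : ExcludedMiddle 0ℓ → ∀ {k n} (M : SSNFA k n) (T : Fin k → LTerm) (y : Fin n → ℕ) →
    Normal T → (SatM M T y ⇔ (¬ ΠSat M T y))
theorem1 em M T y normal =
  mk⇔ (SatM⇒¬ΠSat M T y) (λ ¬Π → em⇒dne em (λ ¬sat → ¬Π (¬SatM⇒ΠSat M T y normal ¬sat)))
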